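{- For every graph $G$, $\mathrm{lcwd}(G)\le \ell(G)+1$, where $\mathrm{lcwd}(G)$ is the linear clique-width and $\ell(G)$ the lettericity of $G$.
   Context: Lettericity: for a finite alphabet $\Sigma$, decoder $\mathcal{P}\subseteq\Sigma^2$ and word $w=w_1\cdots w_n$ over $\Sigma$, the letter graph $G(\mathcal{P},w)$ has vertex set $\{1,\dots,n\}$ with $i<j$ adjacent iff $(w_i,w_j)\in\mathcal{P}$; $\ell(G)$ is the minimum $|\Sigma|$ such that $G$ is isomorphic to some $G(\mathcal{P},w)$ over $\Sigma$. Clique-width expressions build vertex-labelled graphs using the operations: (i) $i(v)$, creation of a new vertex $v$ with label $i$; (ii) $G\oplus H$, disjoint union of two labelled graphs; (iii) $\eta_{i,j}$ ($i\ne j$), adding all edges between vertices labelled $i$ and vertices labelled $j$; (iv) $\rho_{i\to j}$, renaming label $i$ to $j$. An expression using $k$ labels is a $k$-expression; it defines $G$ if the resulting graph, ignoring labels, is $G$. An expression is linear if in every disjoint union operation at least one of the two operands is a single newly created vertex $i(v)$ (equivalently, its expression tree is a caterpillar). The linear clique-width $\mathrm{lcwd}(G)$ is the minimum $k$ such that $G$ is defined by a linear $k$-expression. -}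

module Defs where

open import Data.Nat using (ℕ; zero; suc; _+_; _<_; _≤_; _<ᵇ_)
open import Data.Fin using (Fin; splitAt; _≟_; toℕ)
open import Data.Bool using (Bool; true; false; _∧_; _∨_; if_then_else_)
open import Data.Bool.Properties using (∨-comm)
open import Data.Unit using (⊤)
open import Data.Sum using (_⊎_; inj₁; inj₂; [_,_]′)
open import Data.Product using (Σ; _×_; _,_; ∃)
open import Data.Empty using (⊥)
open import Relation.Nullary using (¬_)
open import Relation.Nullary.Decidable using (⌊_⌋)
open import Relation.Binary.PropositionalEquality using (_≡_; _≢_; refl; subst) renaming (sym to ≡-sym)
open import Function.Bundles using (_↔_; Inverse)

record Graph : Set where
  field
    order : ℕ
    adj   : Fin order → Fin order → Bool
    sym   : ∀ x y → adj x y ≡ adj y x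
    irr   : ∀ x → adj x x ≡ false
open Graph public

_≅_ : Graph → Graph → Set
G ≅ H = Σ (Fin (order G) ↔ Fin (order H)) λ f →
          ∀ x y → adj G x y ≡ adj H (Inverse.to f x) (Inverse.to f y)

-- Alphabet Σ = Fin k, decoder P ⊆ Σ² given as a Boolean predicate,
-- word w = w₁ ⋯ wₙ given as a function Fin n → Fin k.
-- Vertices i < j are adjacent iff (w i , w j) ∈ P.
letterAdj : {k n : ℕ} → (Fin k → Fin k → Bool) → (Fin n → Fin k) →
            Fin n → Fin n → Bool
letterAdj P w i j = ((toℕ i <ᵇ toℕ j) ∧ P (w i) (w j)) ∨ ((toℕ j <ᵇ toℕ i) ∧ P (w j) (w i))

private
  <ᵇ-irr : ∀ m → (m <ᵇ m) ≡ false
  <ᵇ-irr zero = refl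
  <ᵇ-irr (suc m) = <ᵇ-irr m

letterGraph : {k n : ℕ} → (Fin k → Fin k → Bool) → (Fin n → Fin k) → Graph
letterGraph {k} {n} P w = record
  { order = n
  ; adj   = letterAdj P w
  ; sym   = λ x y → ∨-comm ((toℕ x <ᵇ toℕ y) ∧ P (w x) (w y)) _
  ; irr   = λ x → subst (λ b → (b ∧ P (w x) (w x)) ∨ (b ∧ P (w x) (w x)) ≡ false)
                        (≡-sym (<ᵇ-irr (toℕ x))) refl
  }

-- G has a letter-graph representation over an alphabet of size k
-- (so ℓ(G) ≤ k iff HasLetterRep G k; ℓ(G) is the least such k).
HasLetterRep : Graph → ℕ → Set
HasLetterRep G k = Σ (Fin k → Fin k → Bool) λ P →
                   Σ (Fin (order G) → Fin k) λ w → G ≅ letterGraph P w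

data Expr (k : ℕ) : ℕ → Set where
  create : Fin k → Expr k 1
  _⊕_    : {m n : ℕ} → Expr k m → Expr k n → Expr k (m + n)
  η      : {n : ℕ} (i j : Fin k) → i ≢ j → Expr k n → Expr k n
  ρ      : {n : ℕ} (i j : Fin k) → Expr k n → Expr k n

IsCreate : {k n : ℕ} → Expr k n → Set
IsCreate (create _) = ⊤
IsCreate (_ ⊕ _)    = ⊥
IsCreate (η _ _ _ _) = ⊥
IsCreate (ρ _ _ _)  = ⊥

Linear : {k n : ℕ} → Expr k n → Set
Linear (create _)  = ⊤
Linear (e ⊕ f)     = Linear e × Linear f × (IsCreate e ⊎ IsCreate f)
Linear (η _ _ _ e) = Linear e
Linear (ρ _ _ e)   = Linear e

record LGraph (k n : ℕ) : Set where
  field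
    lab  : Fin n → Fin k
    ladj : Fin n → Fin n → Bool
open LGraph public

_==_ : {k : ℕ} → Fin k → Fin k → Bool
a == b = ⌊ a ≟ b ⌋

eval : {k n : ℕ} → Expr k n → LGraph k n
eval (create i) = record { lab = λ _ → i ; ladj = λ _ _ → false }
eval (_⊕_ {m} {n} e f) = record
  { lab  = λ x → [ lab (eval e) , lab (eval f) ]′ (splitAt m x)
  ; ladj = λ x y → go (splitAt m x) (splitAt m y) }
  where
  go : Fin m ⊎ Fin n → Fin m ⊎ Fin n → Bool
  go (inj₁ a) (inj₁ b) = ladj (eval e) a b
  go (inj₂ a) (inj₂ b) = ladj (eval f) a b
  go _ _ = false
eval (η i j _ e) = record
  { lab  = lab (eval e)
  ; ladj = λ x y → ladj (eval e) x y
                   ∨ ((lab (eval e) x == i ∧ lab (eval e) y == j)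
                      ∨ (lab (eval e) x == j ∧ lab (eval e) y == i)) }
eval (ρ i j e) = record
  { lab  = λ x → if lab (eval e) x == i then j else lab (eval e) x
  ; ladj = ladj (eval e) }

Defines : {k n : ℕ} → Expr k n → Graph → Set
Defines {k} {n} e G = Σ (Fin (order G) ↔ Fin n) λ f →
  ∀ x y → adj G x y ≡ ladj (eval e) (Inverse.to f x) (Inverse.to f y)

-- G has a linear k-expression (so lcwd(G) ≤ k iff HasLinearExpr G k).
HasLinearExpr : Graph → ℕ → Set
HasLinearExpr G k = Σ ℕ λ n → Σ (Expr k n) λ e → Linear e × Defines e G

module Submission where

-- Labels are Fin (suc k): label zero is a fresh label and label suc b
-- stands for letter b.  The letter graph G(Q, v) of a word
-- v = v₀ v₁ ⋯ vₙ is built by adding the positions from the last to the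
-- first.  Given a linear expression for v₁ ⋯ vₙ in which every vertex
-- carries the label of its letter, create the vertex v₀ with the fresh
-- label, join the fresh label to every letter b with Q v₀ b (position 0
-- precedes all present vertices, so these are exactly its neighbours),
-- and rename the fresh label to the label of v₀.

open import Defs
open import Data.Nat using (ℕ; zero; suc; _≤_)
open import Data.Fin using (Fin; zero; suc; _≟_)
open import Data.Bool using (Bool; true; false; _∧_; _∨_; if_then_else_)
open import Data.Bool.Properties using (∨-comm; ∨-assoc; ∨-identityʳ; ∧-identityʳ; ∧-zeroʳ)
open import Data.Product using (_,_)
open import Data.Sum using (inj₁)
open import Data.Unit using (tt)
open import Function using (_∘_; id)
open import Function.Construct.Composition using (_↔-∘_)
open import Function.Construct.Identity using (↔-id)
open import Relation.Nullary.Decidable using (⌊⌋-map′)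
open import Relation.Binary.PropositionalEquality
  using (_≡_; refl; trans; cong; cong₂; module ≡-Reasoning)
  renaming (sym to ≡-sym)

anyᶠ : {m : ℕ} → (Fin m → Bool) → Bool
anyᶠ {zero}  f = false
anyᶠ {suc m} f = f zero ∨ anyᶠ (f ∘ suc)

anyᶠ-cong : {m : ℕ} {f g : Fin m → Bool} → (∀ i → f i ≡ g i) → anyᶠ f ≡ anyᶠ g
anyᶠ-cong {zero}  f≗g = refl
anyᶠ-cong {suc m} f≗g = cong₂ _∨_ (f≗g zero) (anyᶠ-cong (f≗g ∘ suc))

anyᶠ-false : {m : ℕ} {f : Fin m → Bool} → (∀ i → f i ≡ false) → anyᶠ f ≡ false
anyᶠ-false {zero}  f≗false = refl
anyᶠ-false {suc m} f≗false rewrite f≗false zero = anyᶠ-false (f≗false ∘ suc)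

==-suc : {m : ℕ} (a b : Fin m) → (suc a == suc b) ≡ (a == b)
==-suc a b = ⌊⌋-map′ _ _ (a ≟ b)

anyᶠ-select : {m : ℕ} (c : Fin m → Bool) (b : Fin m) → anyᶠ (λ i → c i ∧ (b == i)) ≡ c b
anyᶠ-select c zero = begin
  (c zero ∧ true) ∨ anyᶠ (λ i → c (suc i) ∧ false)
    ≡⟨ cong₂ _∨_ (∧-identityʳ _) (anyᶠ-false (λ i → ∧-zeroʳ (c (suc i)))) ⟩
  c zero ∨ false
    ≡⟨ ∨-identityʳ _ ⟩
  c zero ∎
  where open ≡-Reasoning
anyᶠ-select c (suc b) = begin
  (c zero ∧ false) ∨ anyᶠ (λ i → c (suc i) ∧ (suc b == suc i))
    ≡⟨ cong₂ _∨_ (∧-zeroʳ _) (anyᶠ-cong (λ i → cong (c (suc i) ∧_) (==-suc b i))) ⟩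
  anyᶠ (λ i → c (suc i) ∧ (b == i))
    ≡⟨ anyᶠ-select (c ∘ suc) b ⟩
  c (suc b) ∎
  where open ≡-Reasoning

ηEdge : {k : ℕ} → Fin k → Fin k → Fin k → Fin k → Bool
ηEdge i j a a' = (a == i ∧ a' == j) ∨ (a == j ∧ a' == i)

attached : {k : ℕ} → (Fin k → Bool) → Fin (suc k) → Fin (suc k) → Bool
attached S zero    (suc b) = S b
attached S (suc b) zero    = S b
attached S _       _       = false

attached-none : {k : ℕ} (a a' : Fin (suc k)) → attached (λ _ → false) a a' ≡ false
attached-none zero    zero    = refl
attached-none zero    (suc _) = refl
attached-none (suc _) zero    = refl
attached-none (suc _) (suc _) = refl

attached-extend : {k : ℕ} (S : Fin k → Bool) (b₀ : Fin k) (a a' : Fin (suc k)) →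
                  attached (λ b → (b == b₀) ∨ S b) a a' ≡ attached S a a' ∨ ηEdge zero (suc b₀) a a'
attached-extend S b₀ zero    zero     = refl
attached-extend S b₀ zero    (suc b)  = begin
  (b == b₀) ∨ S b                      ≡⟨ ∨-comm (b == b₀) (S b) ⟩
  S b ∨ (b == b₀)                      ≡⟨ cong (S b ∨_) (≡-sym (∨-identityʳ (b == b₀))) ⟩
  S b ∨ ((b == b₀) ∨ false)            ≡⟨ cong (λ t → S b ∨ (t ∨ false)) (≡-sym (==-suc b b₀)) ⟩
  S b ∨ ((suc b == suc b₀) ∨ false)    ∎
  where open ≡-Reasoning
attached-extend S b₀ (suc b) zero     = begin
  (b == b₀) ∨ S b                      ≡⟨ ∨-comm (b == b₀) (S b) ⟩
  S b ∨ (b == b₀)                      ≡⟨ cong (S b ∨_) (≡-sym (∧-identityʳ (b == b₀))) ⟩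
  S b ∨ ((b == b₀) ∧ true)             ≡⟨ cong (λ t → S b ∨ (t ∧ true)) (≡-sym (==-suc b b₀)) ⟩
  S b ∨ ((suc b == suc b₀) ∧ true)     ∎
  where open ≡-Reasoning
attached-extend S b₀ (suc b) (suc b') = ≡-sym (∧-zeroʳ _)

joinFresh : {k m n : ℕ} → (Fin k → Bool) → (Fin m → Fin k) → Expr (suc k) n → Expr (suc k) n
joinFresh {m = zero}  c bs e = e
joinFresh {m = suc m} c bs e with c (bs zero)
... | true  = η zero (suc (bs zero)) (λ ()) (joinFresh c (bs ∘ suc) e)
... | false = joinFresh c (bs ∘ suc) e

chosen : {k m : ℕ} → (Fin k → Bool) → (Fin m → Fin k) → Fin k → Bool
chosen c bs b = anyᶠ (λ i → c (bs i) ∧ (b == bs i))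

-- η never changes labels.
joinFresh-lab : {k m n : ℕ} (c : Fin k → Bool) (bs : Fin m → Fin k) (e : Expr (suc k) n) (x : Fin n) →
                lab (eval (joinFresh c bs e)) x ≡ lab (eval e) x
joinFresh-lab {m = zero}  c bs e x = refl
joinFresh-lab {m = suc m} c bs e x with c (bs zero)
... | true  = joinFresh-lab c (bs ∘ suc) e x
... | false = joinFresh-lab c (bs ∘ suc) e x

joinFresh-ladj : {k m n : ℕ} (c : Fin k → Bool) (bs : Fin m → Fin k) (e : Expr (suc k) n) (x y : Fin n) →
                 ladj (eval (joinFresh c bs e)) x y ≡
                 ladj (eval e) x y ∨ attached (chosen c bs) (lab (eval e) x) (lab (eval e) y)
joinFresh-ladj {m = zero} c bs e x y = begin
  ladj (eval e) x y
    ≡⟨ ≡-sym (∨-identityʳ _) ⟩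
  ladj (eval e) x y ∨ false
    ≡⟨ cong (ladj (eval e) x y ∨_) (≡-sym (attached-none (lab (eval e) x) (lab (eval e) y))) ⟩
  ladj (eval e) x y ∨ attached (λ _ → false) (lab (eval e) x) (lab (eval e) y) ∎
  where open ≡-Reasoning
joinFresh-ladj {m = suc m} c bs e x y with c (bs zero)
... | false = joinFresh-ladj c (bs ∘ suc) e x y
... | true
  rewrite joinFresh-lab c (bs ∘ suc) e x | joinFresh-lab c (bs ∘ suc) e y = begin
  ladj (eval (joinFresh c (bs ∘ suc) e)) x y ∨ ηEdge zero (suc (bs zero)) a a'
    ≡⟨ cong (_∨ ηEdge zero (suc (bs zero)) a a') (joinFresh-ladj c (bs ∘ suc) e x y) ⟩
  (ladj (eval e) x y ∨ attached (chosen c (bs ∘ suc)) a a') ∨ ηEdge zero (suc (bs zero)) a a'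
    ≡⟨ ∨-assoc (ladj (eval e) x y) (attached (chosen c (bs ∘ suc)) a a') (ηEdge zero (suc (bs zero)) a a') ⟩
  ladj (eval e) x y ∨ (attached (chosen c (bs ∘ suc)) a a' ∨ ηEdge zero (suc (bs zero)) a a')
    ≡⟨ cong (ladj (eval e) x y ∨_) (≡-sym (attached-extend (chosen c (bs ∘ suc)) (bs zero) a a')) ⟩
  ladj (eval e) x y ∨ attached (λ b → (b == bs zero) ∨ chosen c (bs ∘ suc) b) a a' ∎
  where
  open ≡-Reasoning
  a a' : Fin (suc _)
  a  = lab (eval e) x
  a' = lab (eval e) y

-- Only η operations are added, so linearity is preserved.
joinFresh-linear : {k m n : ℕ} (c : Fin k → Bool) (bs : Fin m → Fin k) (e : Expr (suc k) n) →
                   Linear e → Linear (joinFresh c bs e)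
joinFresh-linear {m = zero}  c bs e lin = lin
joinFresh-linear {m = suc m} c bs e lin with c (bs zero)
... | true  = joinFresh-linear c (bs ∘ suc) e lin
... | false = joinFresh-linear c (bs ∘ suc) e lin

-- Vertex i of the expression is position i of v.
wordExpr : {k n : ℕ} → (Fin k → Fin k → Bool) → (Fin (suc n) → Fin k) → Expr (suc k) (suc n)
wordExpr {n = zero}  Q v = create (suc (v zero))
wordExpr {n = suc n} Q v =
  ρ zero (suc (v zero)) (joinFresh (Q (v zero)) id (create zero ⊕ wordExpr Q (v ∘ suc)))

wordExpr-lab : {k n : ℕ} (Q : Fin k → Fin k → Bool) (v : Fin (suc n) → Fin k) (x : Fin (suc n)) →
               lab (eval (wordExpr Q v)) x ≡ suc (v x)
wordExpr-lab {n = zero}  Q v zero = refl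
wordExpr-lab {n = suc n} Q v x
  rewrite joinFresh-lab (Q (v zero)) id (create zero ⊕ wordExpr Q (v ∘ suc)) x = relabelled x
  where
  U : Expr _ (suc (suc n))
  U = create zero ⊕ wordExpr Q (v ∘ suc)
  relabelled : ∀ x → (if lab (eval U) x == zero then suc (v zero) else lab (eval U) x) ≡ suc (v x)
  relabelled zero = refl
  relabelled (suc x) rewrite wordExpr-lab Q (v ∘ suc) x = refl

wordExpr-ladj : {k n : ℕ} (Q : Fin k → Fin k → Bool) (v : Fin (suc n) → Fin k) (x y : Fin (suc n)) →
                ladj (eval (wordExpr Q v)) x y ≡ letterAdj Q v x y
wordExpr-ladj {n = zero}  Q v zero zero = refl
wordExpr-ladj {n = suc n} Q v x y
  rewrite joinFresh-ladj (Q (v zero)) id (create zero ⊕ wordExpr Q (v ∘ suc)) x y = edges x y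
  where
  W : Expr _ (suc n)
  W = wordExpr Q (v ∘ suc)
  -- Old vertices keep their adjacency; the new vertex 0 is joined to y
  -- exactly when Q (v 0) (v y).
  edges : ∀ x y → ladj (eval (create zero ⊕ W)) x y ∨
                  attached (chosen (Q (v zero)) id) (lab (eval (create zero ⊕ W)) x) (lab (eval (create zero ⊕ W)) y)
                  ≡ letterAdj Q v x y
  edges zero    zero    = refl
  edges zero    (suc y) rewrite wordExpr-lab Q (v ∘ suc) y =
    trans (anyᶠ-select (Q (v zero)) (v (suc y))) (≡-sym (∨-identityʳ _))
  edges (suc x) zero    rewrite wordExpr-lab Q (v ∘ suc) x =
    anyᶠ-select (Q (v zero)) (v (suc x))
  edges (suc x) (suc y) rewrite wordExpr-lab Q (v ∘ suc) x | wordExpr-lab Q (v ∘ suc) y =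
    trans (∨-identityʳ _) (wordExpr-ladj Q (v ∘ suc) x y)

-- Each step is a disjoint union with a single new vertex.
wordExpr-linear : {k n : ℕ} (Q : Fin k → Fin k → Bool) (v : Fin (suc n) → Fin k) → Linear (wordExpr Q v)
wordExpr-linear {n = zero}  Q v = tt
wordExpr-linear {n = suc n} Q v =
  joinFresh-linear (Q (v zero)) id _ (tt , wordExpr-linear Q (v ∘ suc) , inj₁ tt)

-- Every nonempty letter graph over k letters has a linear (k+1)-expression
-- (nonempty, since expressions always create at least one vertex).
letterGraph-linearExpr : {k n : ℕ} (Q : Fin k → Fin k → Bool) (v : Fin n → Fin k) →
                         1 ≤ n → HasLinearExpr (letterGraph Q v) (suc k)
letterGraph-linearExpr {n = suc n} Q v _ =
  suc n , wordExpr Q v , wordExpr-linear Q v , ↔-id _ , λ x y → ≡-sym (wordExpr-ladj Q v x y)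

hasLinearExpr-≅ : {G H : Graph} {k : ℕ} → G ≅ H → HasLinearExpr H k → HasLinearExpr G k
hasLinearExpr-≅ (f , G≅H) (n , e , lin , g , defines) =
  n , e , lin , g ↔-∘ f , λ x y → trans (G≅H x y) (defines _ _)

theorem9 : (G : Graph) → 1 ≤ order G →
           (k : ℕ) → HasLetterRep G k → HasLinearExpr G (suc k)
theorem9 G nonempty k (P , w , G≅Pw) =
  hasLinearExpr-≅ {G = G} {H = letterGraph P w} G≅Pw (letterGraph-linearExpr P w nonempty)
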